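{- If $G$ is a graph with no isolated vertices, then $\chi_{\mu_2}(G)\le \gamma_t(G)$.
   Context: All graphs are finite, simple and undirected. A $u,v$-geodesic is a shortest $u,v$-path. A set $M\subseteq V(G)$ is a $2$-distance mutual-visibility set if for every two distinct $u,v\in M$ there is a $u,v$-geodesic of length at most $2$ none of whose internal vertices lies in $M$. $\chi_{\mu_2}(G)$ is the minimum number of parts in a partition of $V(G)$ into $2$-distance mutual-visibility sets. $\gamma_t(G)$ is the total domination number: the minimum size of a set $D\subseteq V(G)$ such that every vertex of $G$ has a neighbor in $D$. -}

module Defs where

open import Data.Nat using (ℕ; _≤_)
open import Data.Fin using (Fin)
open import Data.Fin.Subset using (Subset; _∈_; _∉_; ∣_∣)
open import Data.Product using (Σ; ∃; _×_)
open import Data.Sum using (_⊎_)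
open import Relation.Nullary using (¬_; Dec)
open import Relation.Binary.PropositionalEquality using (_≡_; _≢_)

record Graph (n : ℕ) : Set₁ where
  field
    Adj     : Fin n → Fin n → Set
    adj?    : ∀ u v → Dec (Adj u v)
    sym     : ∀ {u v} → Adj u v → Adj v u
    irrefl  : ∀ {u} → ¬ Adj u u

open Graph public

NoIsolated : ∀ {n} → Graph n → Set
NoIsolated {n} G = ∀ (v : Fin n) → ∃ λ u → Adj G v u

-- For distinct u, v: a geodesic of length 1 is an edge uv; a path u-w-v
-- of length 2 is a geodesic exactly when u and v are not adjacent.
VisibleWithin2 : ∀ {n} → Graph n → (Fin n → Set) → Fin n → Fin n → Set
VisibleWithin2 G M u v =
  Adj G u v ⊎ (¬ Adj G u v × ∃ λ w → Adj G u w × Adj G w v × ¬ M w)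

Is2DMV : ∀ {n} → Graph n → (Fin n → Set) → Set
Is2DMV {n} G M = ∀ (u v : Fin n) → M u → M v → u ≢ v → VisibleWithin2 G M u v

-- A partition of V(G) into (at most) k parts, given by the part index of
-- each vertex, all of whose parts are 2-distance mutual-visibility sets.
-- (Allowing empty parts does not change the minimum number of parts.)
Is2DMVPartition : ∀ {n} → Graph n → (k : ℕ) → (Fin n → Fin k) → Set
Is2DMVPartition {n} G k c = ∀ (i : Fin k) → Is2DMV G (λ v → c v ≡ i)

IsChiMu2 : ∀ {n} → Graph n → ℕ → Set
IsChiMu2 {n} G m =
  (∃ λ (c : Fin n → Fin m) → Is2DMVPartition G m c) ×
  (∀ (k : ℕ) (c : Fin n → Fin k) → Is2DMVPartition G k c → m ≤ k)

IsTotalDominating : ∀ {n} → Graph n → Subset n → Set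
IsTotalDominating {n} G D = ∀ (v : Fin n) → ∃ λ u → u ∈ D × Adj G v u

IsGammaT : ∀ {n} → Graph n → ℕ → Set
IsGammaT {n} G m =
  (∃ λ (D : Subset n) → IsTotalDominating G D × ∣ D ∣ ≡ m) ×
  (∀ (D : Subset n) → IsTotalDominating G D → m ≤ ∣ D ∣)

{-# OPTIONS --safe #-}
module Submission where

-- Fix a total dominating set D and let every vertex v choose a neighbour
-- f v ∈ D. Colour v by f v: this uses ∣ D ∣ colours. Two non-adjacent
-- vertices u, v of one colour see each other along u – f u – v, and f u
-- has a different colour, since f u ≡ f (f u) would make f u adjacent to
-- itself.

open import Defs
open import Data.Nat using (ℕ; _≤_)
open import Data.Bool using (true; false)
open import Data.Fin using (Fin; zero; suc)
open import Data.Fin.Properties using (suc-injective)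
open import Data.Fin.Subset using (Subset; _∈_; ∣_∣)
open import Data.Vec using (_∷_)
open import Data.Vec.Base using (here; there)
open import Data.Product using (∃; _,_; proj₁; proj₂; uncurry)
open import Data.Sum using (inj₁; inj₂)
open import Relation.Nullary using (¬_; yes; no)
open import Relation.Binary.PropositionalEquality
  using (_≡_; refl; trans; cong; subst) renaming (sym to ≡-sym)

rank : ∀ {n} (p : Subset n) (x : Fin n) → x ∈ p → Fin ∣ p ∣
rank (true  ∷ p) zero    here      = zero
rank (true  ∷ p) (suc x) (there m) = suc (rank p x m)
rank (false ∷ p) (suc x) (there m) = rank p x m

rank-injective : ∀ {n} (p : Subset n) {x y : Fin n} (x∈p : x ∈ p) (y∈p : y ∈ p) →
  rank p x x∈p ≡ rank p y y∈p → x ≡ y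
rank-injective (true  ∷ p) here       here       _  = refl
rank-injective (true  ∷ p) (there x∈p) (there y∈p) eq =
  cong suc (rank-injective p x∈p y∈p (suc-injective eq))
rank-injective (false ∷ p) (there x∈p) (there y∈p) eq =
  cong suc (rank-injective p x∈p y∈p eq)

NeighbourChoice : ∀ {n} → Graph n → (Fin n → Fin n) → Set
NeighbourChoice {n} G f = ∀ (v : Fin n) → Adj G v (f v)

module _ {n} (G : Graph n) {f : Fin n → Fin n} (f-adj : NeighbourChoice G f) where

  neighbourChoice-constant⇒Is2DMV : (M : Fin n → Set) →
    (∀ {u v} → M u → M v → f u ≡ f v) → Is2DMV G M
  neighbourChoice-constant⇒Is2DMV M f-const u v u∈M v∈M _ with adj? G u v
  ... | yes u~v = inj₁ u~v
  ... | no  u≁v = inj₂ (u≁v , f u , f-adj u , fu~v , fu∉M)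
    where
    fu~v : Adj G (f u) v
    fu~v = subst (λ w → Adj G w v) (f-const v∈M u∈M) (Graph.sym G (f-adj v))
    fu∉M : ¬ M (f u)
    fu∉M fu∈M = irrefl G (subst (Adj G (f u)) (f-const fu∈M u∈M) (f-adj (f u)))

  neighbourChoice-kernel⇒Is2DMVPartition : ∀ {k} (c : Fin n → Fin k) →
    (∀ {u v} → c u ≡ c v → f u ≡ f v) → Is2DMVPartition G k c
  neighbourChoice-kernel⇒Is2DMVPartition c c-kernel i =
    neighbourChoice-constant⇒Is2DMV (λ v → c v ≡ i)
      (λ cu≡i cv≡i → c-kernel (trans cu≡i (≡-sym cv≡i)))

totalDominating⇒Is2DMVPartition : ∀ {n} (G : Graph n) {D : Subset n} →
  IsTotalDominating G D → ∃ λ (c : Fin n → Fin ∣ D ∣) → Is2DMVPartition G ∣ D ∣ c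
totalDominating⇒Is2DMVPartition {n} G {D} D-dominating =
  c , neighbourChoice-kernel⇒Is2DMVPartition G f-adj c
        (λ {u} {v} → rank-injective D (f∈D u) (f∈D v))
  where
  f : Fin n → Fin n
  f v = proj₁ (D-dominating v)
  f∈D : ∀ v → f v ∈ D
  f∈D v = proj₁ (proj₂ (D-dominating v))
  f-adj : NeighbourChoice G f
  f-adj v = proj₂ (proj₂ (D-dominating v))
  c : Fin n → Fin ∣ D ∣
  c v = rank D (f v) (f∈D v)

theorem3p2 : ∀ {n : ℕ} (G : Graph n) → NoIsolated G →
    ∀ (χ γ : ℕ) → IsChiMu2 G χ → IsGammaT G γ → χ ≤ γ
theorem3p2 G _ χ γ (_ , χ-minimal) ((D , D-dominating , ∣D∣≡γ) , _) =
  subst (χ ≤_) ∣D∣≡γ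
    (uncurry (χ-minimal ∣ D ∣) (totalDominating⇒Is2DMVPartition G D-dominating))
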